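{- Let $p, q$ be distinct prime numbers and $n, m \in \mathbb{N}$. Then $Cl_2(\mathbb{Z}_{p^n}) \cong Cl_2(\mathbb{Z}_{q^m})$ if and only if either $\{p^n, q^m\} = \{2^2, 3^1\}$, or ($p \neq 2$, $q \neq 2$, and $p^n - p^{n-1} = q^m - q^{m-1}$).
   Context: For a ring $R$ with identity, $Id(R)$ denotes the set of idempotents and $U(R)$ the set of units of $R$. The clean graph $Cl(R)$ has vertex set $Id(R) \times U(R)$, and two distinct vertices $(e,u)$ and $(f,v)$ are adjacent if and only if $ef=fe=0$ or $uv=vu=1$. $Cl_2(R)$ is the induced subgraph of $Cl(R)$ on $\{(e,u): e \in Id(R)\setminus\{0\},\ u \in U(R)\}$. $\cong$ denotes graph isomorphism. -}

module Defs where

open import Data.Nat using (ℕ; NonZero; _*_; _^_)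
open import Data.Nat.DivMod using (_mod_)
open import Data.Nat.Properties using (m^n≢0)
open import Data.Nat.Primality using (Prime; prime⇒nonZero)
open import Data.Fin using (Fin; toℕ)
open import Data.Fin.Properties using (any?) renaming (_≟_ to _≟ᶠ_)
open import Data.Bool using (Bool; T; _∧_; not)
open import Data.Product using (Σ; _×_; _,_; proj₁; proj₂)
open import Data.Sum using (_⊎_)
open import Relation.Nullary using (¬_)
open import Relation.Nullary.Decidable using (⌊_⌋)
open import Relation.Binary.PropositionalEquality using (_≡_)
open import Function.Bundles using (_⤖_; _⇔_; Bijection)

record Graph : Set₁ where
  field
    V   : Set
    Adj : V → V → Set

open Graph public

_≅_ : Graph → Graph → Set
G ≅ H = Σ (V G ⤖ V H) λ b →
  ∀ x y → Adj G x y ⇔ Adj H (Bijection.to b x) (Bijection.to b y)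

module ZMod (k : ℕ) .{{_ : NonZero k}} where
  Zk : Set
  Zk = Fin k

  0# 1# : Zk
  0# = 0 mod k
  1# = 1 mod k

  _·_ : Zk → Zk → Zk
  a · b = (toℕ a * toℕ b) mod k

  isIdem : Zk → Bool
  isIdem e = ⌊ (e · e) ≟ᶠ e ⌋

  isUnit : Zk → Bool
  isUnit u = ⌊ any? (λ v → (u · v) ≟ᶠ 1# ) ⌋ ∧ ⌊ any? (λ v → (v · u) ≟ᶠ 1#) ⌋

  isVertex₂ : Zk × Zk → Bool
  isVertex₂ (e , u) = isIdem e ∧ not ⌊ e ≟ᶠ 0# ⌋ ∧ isUnit u

  Vertex₂ : Set
  Vertex₂ = Σ (Zk × Zk) λ x → T (isVertex₂ x)

  CleanAdj : Zk × Zk → Zk × Zk → Set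
  CleanAdj (e , u) (f , v) =
    ¬ ((e , u) ≡ (f , v)) ×
    (((e · f ≡ 0#) × (f · e ≡ 0#)) ⊎ ((u · v ≡ 1#) × (v · u ≡ 1#)))

  Cl₂ : Graph
  Cl₂ = record { V = Vertex₂ ; Adj = λ x y → CleanAdj (proj₁ x) (proj₁ y) }

Cl₂-pow : (p : ℕ) → Prime p → (n : ℕ) → Graph
Cl₂-pow p pr n = ZMod.Cl₂ (p ^ n) {{m^n≢0 p n {{prime⇒nonZero pr}}}}

{-# OPTIONS --safe #-}
module Submission where

-- In ℤ_{p^n} the only nonzero idempotent is 1, so Cl₂(ℤ_{p^n}) is, up to isomorphism, the graph on
-- the units in which u ~ v iff u ≠ v and v = u⁻¹: a perfect matching on the units that are not
-- their own inverse, plus one isolated vertex for each square root of 1. Such pairing graphs of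
-- involutions are classified by two numbers, the number of vertices and the number of isolated
-- vertices; here these are φ(p^n) = p^n − p^(n−1) and the number of square roots of 1 in ℤ_{p^n}.
-- For odd p the square roots of 1 are exactly ±1, since p^n cannot split between u − 1 and u + 1.
-- For p = 2: φ(2) = 1 is smaller than every odd totient, ℤ₄ has two square roots of 1 like the
-- odd case, and for n ≥ 3 there is a third one, 2^(n−1) − 1. So 2^n can only match q^m when n = 2
-- and φ(q^m) = 2, i.e. q^m = 3; two odd prime powers match iff their totients agree.

open import Defs
open import Data.Bool using (Bool; true; false; T; not; if_then_else_)
open import Data.Bool.Properties using (T-irrelevant; T-∧)
open import Data.Empty using (⊥-elim)
open import Data.Fin as Fin using (Fin; zero; suc; toℕ)
open import Data.Fin.Permutation using (↔⇒≡)
open import Data.Fin.Properties as Finₚ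
  using (+↔⊎; *↔×; 2↔Bool; 0↔⊥; 1↔⊤; <-cmp; injective⇒≤; toℕ-fromℕ<; toℕ-injective; toℕ<n; any?)
open import Data.Nat as ℕ
  using (ℕ; zero; suc; pred; NonZero; _+_; _*_; _^_; _∸_; _<_; _≤_; _≥_; s≤s; z<s; s<s;
         >-nonZero⁻¹; nonTrivial⇒n>1)
open import Data.Nat.Coprimality as Coprime using (Coprime; coprime?; coprime-Bézout; coprime-divisor)
open import Data.Nat.DivMod
  using (_%_; _/_; _mod_; m≡m%n+[m/n]*n; m<n⇒m%n≡m; %-distribˡ-*; m%n%n≡m%n; [m+kn]%n≡m%n)
open import Data.Nat.Divisibility
  using (_∣_; _∤_; _∣?_; divides; _∣0; ∣-refl; ∣-trans; ∣1⇒≡1; ∣m+n∣m⇒∣n; ∣m∣n⇒∣m+n;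
         ∣m⇒∣m*n; ∣n⇒∣m*n; ∣⇒≤; >⇒∤)
open import Data.Nat.GCD using (module Bézout)
open import Data.Nat.Primality using (Prime; ¬prime[1]; prime⇒irreducible; prime⇒nonZero; prime⇒nonTrivial)
import Data.Nat.Properties as ℕₚ
open import Data.Nat.Tactic.RingSolver using (solve-∀)
open import Data.Product using (Σ; ∃; _×_; _,_; proj₁; proj₂; swap)
import Data.Product as Product
open import Data.Product.Function.Dependent.Propositional using (Σ-↔)
open import Data.Product.Function.NonDependent.Propositional using (_×-↔_)
open import Data.Sum using (_⊎_; inj₁; inj₂)
import Data.Sum as Sum
open import Data.Sum.Function.Propositional using (_⊎-↔_)
open import Function using (_∘_; Injective)
open import Function.Bundles using (_↔_; _⇔_; Inverse; Injection; Equivalence; mk↔ₛ′; mk⇔)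
open import Function.Construct.Composition using (_↔-∘_; _⇔-∘_)
open import Function.Construct.Identity using (↔-id)
open import Function.Construct.Symmetry using (↔-sym)
open import Function.Properties.Bijection using (⤖⇒↔)
open import Function.Properties.Inverse using (↔⇒⤖; ↔⇒↣)
import Function.Related.Propositional as Related
open import Relation.Binary.Definitions using (DecidableEquality; tri<; tri≈; tri>)
open import Relation.Binary.PropositionalEquality
open import Relation.Nullary using (¬_; ¬?; Dec; does; yes; no; contradiction)
open import Relation.Nullary.Decidable
  using (⌊_⌋; toWitness; fromWitness; toWitnessFalse; fromWitnessFalse; via-injection;
         does-⇔; dec-true; dec-false)

private
  variable
    A B C : Set
    a b c d m n p : ℕ

↔-injective : (e : A ↔ B) → Injective _≡_ _≡_ (Inverse.to e)
↔-injective e = Injection.injective (↔⇒↣ e)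

-- Graph isomorphisms

record _≃_ (G H : Graph) : Set where
  constructor isomorphism
  field
    bijection : V G ↔ V H
    adjacency : ∀ x y → Adj G x y ⇔ Adj H (Inverse.to bijection x) (Inverse.to bijection y)

module _ {G H : Graph} where

  ≃⇒≅ : G ≃ H → G ≅ H
  ≃⇒≅ (isomorphism b adj) = ↔⇒⤖ b , adj

  ≅⇒≃ : G ≅ H → G ≃ H
  ≅⇒≃ (b , adj) = isomorphism (⤖⇒↔ b) adj

  ≃-sym : G ≃ H → H ≃ G
  ≃-sym (isomorphism b adj) = isomorphism (↔-sym b) λ x y → mk⇔
    (λ x~y → Equivalence.from (adj (from x) (from y))
               (subst₂ (Adj H) (sym (strictlyInverseˡ x)) (sym (strictlyInverseˡ y)) x~y))
    (λ x~y → subst₂ (Adj H) (strictlyInverseˡ x) (strictlyInverseˡ y)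
               (Equivalence.to (adj (from x) (from y)) x~y))
    where open Inverse b

≃-trans : {G H K : Graph} → G ≃ H → H ≃ K → G ≃ K
≃-trans (isomorphism b adj) (isomorphism c adj′) =
  isomorphism (c ↔-∘ b) λ x y → adj′ (Inverse.to b x) (Inverse.to b y) ⇔-∘ adj x y

≅⇔≃-cong : {G G′ H H′ : Graph} → G ≃ G′ → H ≃ H′ → G ≅ H ⇔ G′ ≃ H′
≅⇔≃-cong G≃G′ H≃H′ = mk⇔ (λ G≅H → ≃-trans (≃-sym G≃G′) (≃-trans (≅⇒≃ G≅H) H≃H′))
                          (λ G′≃H′ → ≃⇒≅ (≃-trans G≃G′ (≃-trans G′≃H′ (≃-sym H≃H′))))

Isolated : (G : Graph) → V G → Set
Isolated G x = ∀ y → ¬ Adj G x y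

≃-preserves-isolated : {G H : Graph} (i : G ≃ H) {x : V G} →
  Isolated G x → Isolated H (Inverse.to (_≃_.bijection i) x)
≃-preserves-isolated {H = H} (isomorphism b adj) {x} x-isolated y bx~y =
  x-isolated (from y) (Equivalence.from (adj x (from y)) (subst (Adj H (to x)) (sym (strictlyInverseˡ y)) bx~y))
  where open Inverse b

-- Counting decidable subsets

proj₁-injective : {P : A → Bool} {x y : Σ A (T ∘ P)} → proj₁ x ≡ proj₁ y → x ≡ y
proj₁-injective {x = x , _} {y = .x , _} refl = cong (x ,_) (T-irrelevant _ _)

T⇔⇒≡does : ∀ {b} (a? : Dec A) → T b ⇔ A → b ≡ does a?
T⇔⇒≡does {b = true}  (yes _) _   = refl
T⇔⇒≡does {b = true}  (no ¬a) b⇔a = contradiction (Equivalence.to b⇔a _) ¬a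
T⇔⇒≡does {b = false} (yes a) b⇔a = ⊥-elim (Equivalence.from b⇔a a)
T⇔⇒≡does {b = false} (no _)  _   = refl

count : (Fin n → Bool) → ℕ
count {zero}  P = 0
count {suc n} P = (if P zero then 1 else 0) + count (P ∘ suc)

count-cong : {P R : Fin n → Bool} → (∀ i → P i ≡ R i) → count P ≡ count R
count-cong {zero}  _   = refl
count-cong {suc n} P≡R = cong₂ _+_ (cong (λ b → if b then 1 else 0) (P≡R zero)) (count-cong (P≡R ∘ suc))

T↔Fin : (b : Bool) → T b ↔ Fin (if b then 1 else 0)
T↔Fin true  = ↔-sym 1↔⊤
T↔Fin false = ↔-sym 0↔⊥

subset-Fin-suc↔ : (P : Fin (suc n) → Bool) →
  Σ (Fin (suc n)) (T ∘ P) ↔ (T (P zero) ⊎ Σ (Fin n) (T ∘ P ∘ suc))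
subset-Fin-suc↔ P = mk↔ₛ′ split join
  (λ { (inj₁ _) → refl ; (inj₂ _) → refl }) (λ { (zero , _) → refl ; (suc _ , _) → refl })
  where
  split : Σ (Fin _) (T ∘ P) → T (P zero) ⊎ Σ (Fin _) (T ∘ P ∘ suc)
  split (zero  , p) = inj₁ p
  split (suc i , p) = inj₂ (i , p)
  join : T (P zero) ⊎ Σ (Fin _) (T ∘ P ∘ suc) → Σ (Fin _) (T ∘ P)
  join (inj₁ p)       = zero , p
  join (inj₂ (i , p)) = suc i , p

subset↔Fin-count : (P : Fin n → Bool) → Σ (Fin n) (T ∘ P) ↔ Fin (count P)
subset↔Fin-count {zero}  P = mk↔ₛ′ (λ ()) (λ ()) (λ ()) (λ ())
subset↔Fin-count {suc n} P = begin
  Σ (Fin (suc n)) (T ∘ P)                                ↔⟨ subset-Fin-suc↔ P ⟩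
  (T (P zero) ⊎ Σ (Fin n) (T ∘ P ∘ suc))                 ↔⟨ T↔Fin (P zero) ⊎-↔ subset↔Fin-count (P ∘ suc) ⟩
  (Fin (if P zero then 1 else 0) ⊎ Fin (count (P ∘ suc))) ↔⟨ +↔⊎ ⟨
  Fin (count P)                                          ∎
  where open Related.EquationalReasoning {k = Related.bijection}

subset-transport : (e : A ↔ Fin n) (P : A → Bool) → Σ A (T ∘ P) ↔ Σ (Fin n) (T ∘ P ∘ Inverse.from e)
subset-transport e P = ↔-sym (Σ-↔ (↔-sym e) (↔-id _))

two-element↔Fin2 : {x y : A} → x ≢ y → (∀ z → z ≡ x ⊎ z ≡ y) → A ↔ Fin 2
two-element↔Fin2 {A = A} {x} {y} x≢y cover = mk↔ₛ′ to from to-from from-to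
  where
  to : A → Fin 2
  to z = Sum.[ (λ _ → zero) , (λ _ → suc zero) ] (cover z)
  from : Fin 2 → A
  from zero       = x
  from (suc zero) = y
  to-from : ∀ i → to (from i) ≡ i
  to-from zero with cover x
  ... | inj₁ _   = refl
  ... | inj₂ x≡y = contradiction x≡y x≢y
  to-from (suc zero) with cover y
  ... | inj₁ y≡x = contradiction (sym y≡x) x≢y
  ... | inj₂ _   = refl
  from-to : ∀ z → from (to z) ≡ z
  from-to z with cover z
  ... | inj₁ z≡x = sym z≡x
  ... | inj₂ z≡y = sym z≡y

three-distinct⇒3≤ : A ↔ Fin n → {x y z : A} → x ≢ y → x ≢ z → y ≢ z → 3 ≤ n
three-distinct⇒3≤ {A = A} e {x} {y} {z} x≢y x≢z y≢z = injective⇒≤ (pick-injective ∘ ↔-injective e)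
  where
  pick : Fin 3 → A
  pick zero             = x
  pick (suc zero)       = y
  pick (suc (suc zero)) = z
  pick-injective : Injective _≡_ _≡_ pick
  pick-injective {zero}           {zero}           _   = refl
  pick-injective {zero}           {suc zero}       x≡y = contradiction x≡y x≢y
  pick-injective {zero}           {suc (suc zero)} x≡z = contradiction x≡z x≢z
  pick-injective {suc zero}       {zero}           y≡x = contradiction (sym y≡x) x≢y
  pick-injective {suc zero}       {suc zero}       _   = refl
  pick-injective {suc zero}       {suc (suc zero)} y≡z = contradiction y≡z y≢z
  pick-injective {suc (suc zero)} {zero}           z≡x = contradiction (sym z≡x) x≢z
  pick-injective {suc (suc zero)} {suc zero}       z≡y = contradiction (sym z≡y) y≢z
  pick-injective {suc (suc zero)} {suc (suc zero)} _   = refl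

countBelow : ℕ → (ℕ → Bool) → ℕ
countBelow zero    Q = 0
countBelow (suc n) Q = (if Q 0 then 1 else 0) + countBelow n (Q ∘ suc)

count-toℕ : ∀ n (Q : ℕ → Bool) → count {n} (Q ∘ toℕ) ≡ countBelow n Q
count-toℕ zero    Q = refl
count-toℕ (suc n) Q = cong ((if Q 0 then 1 else 0) +_) (count-toℕ n (Q ∘ suc))

countBelow-cong : ∀ n {Q R : ℕ → Bool} → (∀ i → i < n → Q i ≡ R i) → countBelow n Q ≡ countBelow n R
countBelow-cong zero    _   = refl
countBelow-cong (suc n) Q≡R = cong₂ _+_ (cong (λ b → if b then 1 else 0) (Q≡R 0 z<s))
  (countBelow-cong n (λ i i<n → Q≡R (suc i) (s<s i<n)))

countBelow-true : ∀ n → countBelow n (λ _ → true) ≡ n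
countBelow-true zero    = refl
countBelow-true (suc n) = cong suc (countBelow-true n)

countBelow-+ : ∀ m n (Q : ℕ → Bool) → countBelow (m + n) Q ≡ countBelow m Q + countBelow n (Q ∘ (m +_))
countBelow-+ zero    n Q = refl
countBelow-+ (suc m) n Q = trans (cong ((if Q 0 then 1 else 0) +_) (countBelow-+ m n (Q ∘ suc)))
  (sym (ℕₚ.+-assoc (if Q 0 then 1 else 0) _ _))

countBelow-periodic : ∀ p (Q : ℕ → Bool) → (∀ i → Q (p + i) ≡ Q i) →
  ∀ j → countBelow (j * p) Q ≡ j * countBelow p Q
countBelow-periodic p Q Q-periodic zero    = refl
countBelow-periodic p Q Q-periodic (suc j) = begin
  countBelow (p + j * p) Q                          ≡⟨ countBelow-+ p (j * p) Q ⟩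
  countBelow p Q + countBelow (j * p) (Q ∘ (p +_))  ≡⟨ cong (countBelow p Q +_) (countBelow-cong (j * p) λ i _ → Q-periodic i) ⟩
  countBelow p Q + countBelow (j * p) Q             ≡⟨ cong (countBelow p Q +_) (countBelow-periodic p Q Q-periodic j) ⟩
  countBelow p Q + j * countBelow p Q               ∎
  where open ≡-Reasoning

notDivisibleBy : ℕ → ℕ → Bool
notDivisibleBy p i = does (¬? (p ∣? i))

countBelow-notDivisibleBy : ∀ p j → countBelow (j * suc p) (notDivisibleBy (suc p)) ≡ j * p
countBelow-notDivisibleBy p j = begin
  countBelow (j * suc p) (notDivisibleBy (suc p))  ≡⟨ countBelow-periodic (suc p) _ shift j ⟩
  j * countBelow (suc p) (notDivisibleBy (suc p))  ≡⟨ cong (j *_) one-period ⟩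
  j * p                                            ∎
  where
  open ≡-Reasoning
  shift : ∀ i → notDivisibleBy (suc p) (suc p + i) ≡ notDivisibleBy (suc p) i
  shift i = cong not (does-⇔ (mk⇔ (λ ∣p+i → ∣m+n∣m⇒∣n ∣p+i ∣-refl) (∣m∣n⇒∣m+n ∣-refl))
                             (suc p ∣? (suc p + i)) (suc p ∣? i))
  one-period : countBelow (suc p) (notDivisibleBy (suc p)) ≡ p
  one-period = begin
    countBelow (suc p) (notDivisibleBy (suc p))  ≡⟨ cong (λ b → (if not b then 1 else 0) + rest) (dec-true (suc p ∣? 0) (suc p ∣0)) ⟩
    rest                                         ≡⟨ countBelow-cong p (λ i i<p → cong not (dec-false (suc p ∣? suc i) (>⇒∤ (s<s i<p)))) ⟩
    countBelow p (λ _ → true)                    ≡⟨ countBelow-true p ⟩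
    p                                            ∎
    where rest = countBelow p (notDivisibleBy (suc p) ∘ suc)

countBelow-notDivisibleBy-^ : ∀ p .{{_ : NonZero p}} n → n ≥ 1 →
  countBelow (p ^ n) (notDivisibleBy p) ≡ p ^ n ∸ p ^ (n ∸ 1)
countBelow-notDivisibleBy-^ (suc p) (suc j) _ = begin
  countBelow (suc p * x) Q  ≡⟨ cong (λ m → countBelow m Q) (ℕₚ.*-comm (suc p) x) ⟩
  countBelow (x * suc p) Q  ≡⟨ countBelow-notDivisibleBy p x ⟩
  x * p                     ≡⟨ ℕₚ.*-comm x p ⟩
  p * x                     ≡⟨ ℕₚ.m+n∸m≡n x (p * x) ⟨
  suc p * x ∸ x             ∎
  where
  open ≡-Reasoning
  x = suc p ^ j
  Q = notDivisibleBy (suc p)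

-- Involutions and their pairing graphs

record Conjugate (σ : A → A) (τ : B → B) : Set where
  constructor conjugate
  field
    bijection : A ↔ B
    commutes  : ∀ x → Inverse.to bijection (σ x) ≡ τ (Inverse.to bijection x)

conjugate-by-from : {σ : A → A} {τ : B → B} (h : A ↔ B) →
  (∀ y → Inverse.from h (τ y) ≡ σ (Inverse.from h y)) → Conjugate σ τ
conjugate-by-from {σ = σ} {τ} h from-τ = conjugate h λ x → begin
  to (σ x)              ≡⟨ cong (to ∘ σ) (strictlyInverseʳ x) ⟨
  to (σ (from (to x)))  ≡⟨ cong to (from-τ (to x)) ⟨
  to (from (τ (to x)))  ≡⟨ strictlyInverseˡ (τ (to x)) ⟩
  τ (to x)              ∎
  where open Inverse h
        open ≡-Reasoning

conjugate-sym : {σ : A → A} {τ : B → B} → Conjugate σ τ → Conjugate τ σ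
conjugate-sym (conjugate h to-σ) = conjugate-by-from (↔-sym h) to-σ

conjugate-trans : {σ : A → A} {τ : B → B} {ρ : C → C} → Conjugate σ τ → Conjugate τ ρ → Conjugate σ ρ
conjugate-trans (conjugate g g-σ) (conjugate h h-τ) =
  conjugate (h ↔-∘ g) λ x → trans (cong (Inverse.to h) (g-σ x)) (h-τ _)

flipTag : A ⊎ B × Bool → A ⊎ B × Bool
flipTag = Sum.map₂ (Product.map₂ not)

flipTag-conjugate : {A′ B′ : Set} → A ↔ A′ → B ↔ B′ → Conjugate (flipTag {A} {B}) (flipTag {A′} {B′})
flipTag-conjugate a b = conjugate (a ⊎-↔ (b ×-↔ ↔-id Bool)) λ { (inj₁ _) → refl ; (inj₂ _) → refl }

record FiniteInvolution : Set₁ where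
  field
    Carrier      : Set
    size         : ℕ
    enumeration  : Carrier ↔ Fin size
    σ            : Carrier → Carrier
    σ-involutive : ∀ x → σ (σ x) ≡ x

pairingGraph : FiniteInvolution → Graph
pairingGraph I = record { V = Carrier ; Adj = λ x y → x ≢ y × y ≡ σ x }
  where open FiniteInvolution I

module FiniteInvolutionProperties (I : FiniteInvolution) where
  open FiniteInvolution I

  index : Carrier → Fin size
  index = Inverse.to enumeration

  _≟_ : DecidableEquality Carrier
  _≟_ = via-injection (↔⇒↣ enumeration) Finₚ._≟_

  isFixed isLeader : Carrier → Bool
  isFixed  x = ⌊ σ x ≟ x ⌋
  isLeader x = ⌊ index x Finₚ.<? index (σ x) ⌋

  Fixed Leader : Set
  Fixed  = Σ Carrier (T ∘ isFixed)
  Leader = Σ Carrier (T ∘ isLeader)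

  fixedCount leaderCount : ℕ
  fixedCount  = count (isFixed  ∘ Inverse.from enumeration)
  leaderCount = count (isLeader ∘ Inverse.from enumeration)

  Fixed↔Fin : Fixed ↔ Fin fixedCount
  Fixed↔Fin = subset↔Fin-count _ ↔-∘ subset-transport enumeration isFixed

  Leader↔Fin : Leader ↔ Fin leaderCount
  Leader↔Fin = subset↔Fin-count _ ↔-∘ subset-transport enumeration isLeader

  index-σσ : ∀ x → index (σ (σ x)) ≡ index x
  index-σσ x = cong index (σ-involutive x)

  σσ<σ : ∀ {x} → T (isLeader x) → index (σ (σ x)) Fin.< index (σ x)
  σσ<σ {x} x-leader = subst (Fin._< index (σ x)) (sym (index-σσ x)) (toWitness x-leader)

  decompose : Carrier → Fixed ⊎ Leader × Bool
  decompose x with <-cmp (index x) (index (σ x))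
  ... | tri< x<σx _ _ = inj₂ ((x , fromWitness x<σx) , true)
  ... | tri≈ _ x≡σx _ = inj₁ (x , fromWitness (sym (↔-injective enumeration x≡σx)))
  ... | tri> _ _ σx<x = inj₂ ((σ x , σ-leader) , false)
    where σ-leader = fromWitness (subst (index (σ x) Fin.<_) (sym (index-σσ x)) σx<x)

  recompose : Fixed ⊎ Leader × Bool → Carrier
  recompose (inj₁ (x , _))           = x
  recompose (inj₂ ((x , _) , true))  = x
  recompose (inj₂ ((x , _) , false)) = σ x

  recompose-decompose : ∀ x → recompose (decompose x) ≡ x
  recompose-decompose x with <-cmp (index x) (index (σ x))
  ... | tri< _ _ _ = refl
  ... | tri≈ _ _ _ = refl
  ... | tri> _ _ _ = σ-involutive x

  decompose-recompose : ∀ z → decompose (recompose z) ≡ z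
  decompose-recompose (inj₁ (x , x-fixed)) with <-cmp (index x) (index (σ x))
  ... | tri< _ x≢σx _ = contradiction (cong index (sym (toWitness x-fixed))) x≢σx
  ... | tri≈ _ _ _    = cong inj₁ (proj₁-injective refl)
  ... | tri> _ x≢σx _ = contradiction (cong index (sym (toWitness x-fixed))) x≢σx
  decompose-recompose (inj₂ ((x , x-leader) , true)) with <-cmp (index x) (index (σ x))
  ... | tri< _ _ _    = cong (λ l → inj₂ (l , true)) (proj₁-injective refl)
  ... | tri≈ x≮σx _ _ = contradiction (toWitness x-leader) x≮σx
  ... | tri> x≮σx _ _ = contradiction (toWitness x-leader) x≮σx
  decompose-recompose (inj₂ ((x , x-leader) , false)) with <-cmp (index (σ x)) (index (σ (σ x)))
  ... | tri< _ _ σσx≮σx = contradiction (σσ<σ x-leader) σσx≮σx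
  ... | tri≈ _ _ σσx≮σx = contradiction (σσ<σ x-leader) σσx≮σx
  ... | tri> _ _ _      = cong (λ l → inj₂ (l , false)) (proj₁-injective (σ-involutive x))

  recompose-flipTag : ∀ z → recompose (flipTag z) ≡ σ (recompose z)
  recompose-flipTag (inj₁ (x , x-fixed))     = sym (toWitness x-fixed)
  recompose-flipTag (inj₂ ((x , _) , true))  = refl
  recompose-flipTag (inj₂ ((x , _) , false)) = sym (σ-involutive x)

  orbitDecomposition : Conjugate σ (flipTag {Fixed} {Leader})
  orbitDecomposition = conjugate-by-from
    (mk↔ₛ′ decompose recompose decompose-recompose recompose-decompose) recompose-flipTag

  normalForm : Conjugate σ (flipTag {Fin fixedCount} {Fin leaderCount})
  normalForm = conjugate-trans orbitDecomposition (flipTag-conjugate Fixed↔Fin Leader↔Fin)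

  size≡fixedCount+leaderCount*2 : size ≡ fixedCount + leaderCount * 2
  size≡fixedCount+leaderCount*2 = ↔⇒≡ (begin
    Fin size                                   ↔⟨ enumeration ⟨
    Carrier                                    ↔⟨ Conjugate.bijection normalForm ⟩
    (Fin fixedCount ⊎ Fin leaderCount × Bool)  ↔⟨ ↔-id _ ⊎-↔ (↔-id _ ×-↔ 2↔Bool) ⟨
    (Fin fixedCount ⊎ Fin leaderCount × Fin 2) ↔⟨ ↔-id _ ⊎-↔ *↔× ⟨
    (Fin fixedCount ⊎ Fin (leaderCount * 2))   ↔⟨ +↔⊎ ⟨
    Fin (fixedCount + leaderCount * 2)         ∎)
    where open Related.EquationalReasoning {k = Related.bijection}

  fixed⇒isolated : ∀ {x} → σ x ≡ x → Isolated (pairingGraph I) x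
  fixed⇒isolated σx≡x y (x≢y , y≡σx) = x≢y (sym (trans y≡σx σx≡x))

  isolated⇒fixed : ∀ {x} → Isolated (pairingGraph I) x → σ x ≡ x
  isolated⇒fixed {x} x-isolated with σ x ≟ x
  ... | yes σx≡x = σx≡x
  ... | no  σx≢x = contradiction (σx≢x ∘ sym , refl) (x-isolated (σ x))

module _ {I J : FiniteInvolution} where
  private
    module I = FiniteInvolution I
    module J = FiniteInvolution J
    module Iₚ = FiniteInvolutionProperties I
    module Jₚ = FiniteInvolutionProperties J

  conjugate⇒≃ : Conjugate I.σ J.σ → pairingGraph I ≃ pairingGraph J
  conjugate⇒≃ (conjugate h h-σ) = isomorphism h λ x y → mk⇔
    (λ (x≢y , y≡σx) → x≢y ∘ ↔-injective h , trans (cong (Inverse.to h) y≡σx) (h-σ x))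
    (λ (hx≢hy , hy≡σhx) → hx≢hy ∘ cong (Inverse.to h) , ↔-injective h (trans hy≡σhx (sym (h-σ x))))

  counts⇒≃ : I.size ≡ J.size → Iₚ.fixedCount ≡ Jₚ.fixedCount → pairingGraph I ≃ pairingGraph J
  counts⇒≃ size≡ fixed≡ = conjugate⇒≃ (conjugate-trans Iₚ.normalForm
    (subst₂ (λ f l → Conjugate (flipTag {Fin f} {Fin l}) J.σ) (sym fixed≡) (sym leader≡)
            (conjugate-sym Jₚ.normalForm)))
    where
    leader≡ : Iₚ.leaderCount ≡ Jₚ.leaderCount
    leader≡ = ℕₚ.*-cancelʳ-≡ _ _ 2 (ℕₚ.+-cancelˡ-≡ Iₚ.fixedCount _ _ (begin
      Iₚ.fixedCount + Iₚ.leaderCount * 2 ≡⟨ Iₚ.size≡fixedCount+leaderCount*2 ⟨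
      I.size                             ≡⟨ size≡ ⟩
      J.size                             ≡⟨ Jₚ.size≡fixedCount+leaderCount*2 ⟩
      Jₚ.fixedCount + Jₚ.leaderCount * 2 ≡⟨ cong (_+ Jₚ.leaderCount * 2) fixed≡ ⟨
      Iₚ.fixedCount + Jₚ.leaderCount * 2 ∎))
      where open ≡-Reasoning

  ≃⇒size≡ : pairingGraph I ≃ pairingGraph J → I.size ≡ J.size
  ≃⇒size≡ (isomorphism b _) = ↔⇒≡ (J.enumeration ↔-∘ (b ↔-∘ ↔-sym I.enumeration))

  ≃-fixed : pairingGraph I ≃ pairingGraph J → Iₚ.Fixed → Jₚ.Fixed
  ≃-fixed iso (x , x-fixed) = Inverse.to (_≃_.bijection iso) x ,
    fromWitness (Jₚ.isolated⇒fixed (≃-preserves-isolated iso (Iₚ.fixed⇒isolated (toWitness x-fixed))))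

≃⇒fixedCount≡ : {I J : FiniteInvolution} → pairingGraph I ≃ pairingGraph J →
  FiniteInvolutionProperties.fixedCount I ≡ FiniteInvolutionProperties.fixedCount J
≃⇒fixedCount≡ {I} {J} iso@(isomorphism b _) = ↔⇒≡ (Jₚ.Fixed↔Fin ↔-∘ (Fixed↔ ↔-∘ ↔-sym Iₚ.Fixed↔Fin))
  where
  module Iₚ = FiniteInvolutionProperties I
  module Jₚ = FiniteInvolutionProperties J
  Fixed↔ : Iₚ.Fixed ↔ Jₚ.Fixed
  Fixed↔ = mk↔ₛ′ (≃-fixed {I} {J} iso) (≃-fixed {J} {I} (≃-sym iso))
    (λ y → proj₁-injective (Inverse.strictlyInverseˡ b (proj₁ y)))
    (λ x → proj₁-injective (Inverse.strictlyInverseʳ b (proj₁ x)))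

pairingGraph-≃⇔counts : {I J : FiniteInvolution} → pairingGraph I ≃ pairingGraph J ⇔
  (FiniteInvolution.size I ≡ FiniteInvolution.size J ×
   FiniteInvolutionProperties.fixedCount I ≡ FiniteInvolutionProperties.fixedCount J)
pairingGraph-≃⇔counts {I} {J} = mk⇔
  (λ iso → ≃⇒size≡ {I} {J} iso , ≃⇒fixedCount≡ {I} {J} iso)
  (λ (size≡ , fixed≡) → counts⇒≃ {I} {J} size≡ fixed≡)

-- Arithmetic of prime powers

prime≥2 : Prime p → 2 ≤ p
prime≥2 {p} p-prime = nonTrivial⇒n>1 p {{prime⇒nonTrivial p-prime}}

odd-prime≥3 : Prime p → p ≢ 2 → 3 ≤ p
odd-prime≥3 p-prime p≢2 = ℕₚ.≤∧≢⇒< (prime≥2 p-prime) (p≢2 ∘ sym)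

prime∤1 : Prime p → p ∤ 1
prime∤1 p-prime p∣1 = ¬prime[1] (subst Prime (∣1⇒≡1 p∣1) p-prime)

prime-power>1 : Prime p → ∀ n → n ≥ 1 → 1 < p ^ n
prime-power>1 {p} p-prime n n≥1 = ℕₚ.^-monoʳ-< p (prime≥2 p-prime) n≥1

prime∤⇒coprime : Prime p → p ∤ a → Coprime p a
prime∤⇒coprime p-prime p∤a (d∣p , d∣a) with prime⇒irreducible p-prime d∣p
... | inj₁ d≡1  = d≡1
... | inj₂ refl = contradiction d∣a p∤a

coprime-*ˡ : Coprime a c → Coprime b c → Coprime (a * b) c
coprime-*ˡ a⊥c b⊥c {d} (d∣ab , d∣c) = b⊥c (coprime-divisor d⊥a d∣ab , d∣c)
  where
  d⊥a : Coprime d _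
  d⊥a (e∣d , e∣a) = a⊥c (e∣a , ∣-trans e∣d d∣c)

coprime-^ˡ : Coprime a c → ∀ n → Coprime (a ^ n) c
coprime-^ˡ a⊥c zero    (d∣1 , _) = ∣1⇒≡1 d∣1
coprime-^ˡ a⊥c (suc n) = coprime-*ˡ a⊥c (coprime-^ˡ a⊥c n)

prime-power-∣-cancel : Prime p → p ∤ a → ∀ n → p ^ n ∣ a * b → p ^ n ∣ b
prime-power-∣-cancel p-prime p∤a n = coprime-divisor (coprime-^ˡ (prime∤⇒coprime p-prime p∤a) n)

coprime-prime-power⇔∤ : Prime p → ∀ n → n ≥ 1 → Coprime a (p ^ n) ⇔ p ∤ a
coprime-prime-power⇔∤ {p} {a} p-prime (suc n) _ = mk⇔ coprime⇒∤ ∤⇒coprime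
  where
  coprime⇒∤ : Coprime a (p ^ suc n) → p ∤ a
  coprime⇒∤ a⊥pⁿ p∣a = prime∤1 p-prime (subst (p ∣_) (a⊥pⁿ (p∣a , p∣pⁿ)) ∣-refl)
    where p∣pⁿ = divides (p ^ n) (ℕₚ.*-comm p (p ^ n))
  ∤⇒coprime : p ∤ a → Coprime a (p ^ suc n)
  ∤⇒coprime p∤a = Coprime.sym (coprime-^ˡ (prime∤⇒coprime p-prime p∤a) (suc n))

∣∧<⇒≡0 : d ∣ m → m < d → m ≡ 0
∣∧<⇒≡0 {m = zero}  _   _   = refl
∣∧<⇒≡0 {m = suc m} d∣m m<d = contradiction d∣m (>⇒∤ m<d)

square-suc : ∀ z → suc z * suc z ≡ 1 + z * suc (suc z)
square-suc = solve-∀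

idempotent-mod-prime-power : Prime p → ∀ n a q → a < p ^ n → a * a ≡ a + q * p ^ n → a ≡ 0 ⊎ a ≡ 1
idempotent-mod-prime-power         p-prime n zero    q _   _  = inj₁ refl
idempotent-mod-prime-power {p = p} p-prime n (suc y) q a<pⁿ eq = cases (p ∣? y)
  where
  pⁿ∣[1+y]y : p ^ n ∣ suc y * y
  pⁿ∣[1+y]y = divides q (ℕₚ.+-cancelˡ-≡ (suc y) _ _ (trans (sym (ℕₚ.*-suc (suc y) y)) eq))
  cases : Dec (p ∣ y) → suc y ≡ 0 ⊎ suc y ≡ 1
  cases (yes p∣y) = inj₂ (cong suc (∣∧<⇒≡0 (prime-power-∣-cancel p-prime p∤1+y n pⁿ∣[1+y]y)
                                            (ℕₚ.<-trans (ℕₚ.n<1+n y) a<pⁿ)))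
    where
    p∤1+y : p ∤ suc y
    p∤1+y p∣1+y = prime∤1 p-prime (∣m+n∣m⇒∣n (subst (p ∣_) (ℕₚ.+-comm 1 y) p∣1+y) p∣y)
  cases (no p∤y) = contradiction
    (∣⇒≤ (prime-power-∣-cancel p-prime p∤y n (subst (p ^ n ∣_) (ℕₚ.*-comm (suc y) y) pⁿ∣[1+y]y)))
    (ℕₚ.<⇒≱ a<pⁿ)

square-root-of-one-mod-odd-prime-power : Prime p → p ≢ 2 → ∀ n a q → a < p ^ n → a * a ≡ 1 + q * p ^ n →
  a ≡ 1 ⊎ a ≡ pred (p ^ n)
square-root-of-one-mod-odd-prime-power         p-prime p≢2 n zero    q _   ()
square-root-of-one-mod-odd-prime-power {p = p} p-prime p≢2 n (suc z) q a<pⁿ eq = cases (p ∣? z)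
  where
  pⁿ∣z[2+z] : p ^ n ∣ z * suc (suc z)
  pⁿ∣z[2+z] = divides q (ℕₚ.suc-injective (trans (sym (square-suc z)) eq))
  cases : Dec (p ∣ z) → suc z ≡ 1 ⊎ suc z ≡ pred (p ^ n)
  cases (yes p∣z) = inj₁ (cong suc (∣∧<⇒≡0 pⁿ∣z (ℕₚ.<-trans (ℕₚ.n<1+n z) a<pⁿ)))
    where
    p∤2+z : p ∤ suc (suc z)
    p∤2+z p∣2+z = p≢2 (ℕₚ.≤-antisym (∣⇒≤ (∣m+n∣m⇒∣n (subst (p ∣_) (ℕₚ.+-comm 2 z) p∣2+z) p∣z)) (prime≥2 p-prime))
    pⁿ∣z = prime-power-∣-cancel p-prime p∤2+z n (subst (p ^ n ∣_) (ℕₚ.*-comm z (suc (suc z))) pⁿ∣z[2+z])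
  cases (no p∤z) = inj₂ (cong pred (ℕₚ.≤-antisym a<pⁿ (∣⇒≤ (prime-power-∣-cancel p-prime p∤z n pⁿ∣z[2+z]))))

totient-suc : ∀ q j → q ^ suc j ∸ q ^ j ≡ (q ∸ 1) * q ^ j
totient-suc q j = sym (trans (ℕₚ.*-distribʳ-∸ (q ^ j) q 1) (cong (q * q ^ j ∸_) (ℕₚ.*-identityˡ (q ^ j))))

odd-totient≥2 : ∀ q → 3 ≤ q → ∀ m → m ≥ 1 → 2 ≤ q ^ m ∸ q ^ (m ∸ 1)
odd-totient≥2 q@(suc (suc (suc r))) (s≤s (s≤s (s≤s _))) (suc j) _ =
  subst (2 ≤_) (sym (totient-suc q j)) (ℕₚ.*-mono-≤ (ℕₚ.m≤m+n 2 r) (ℕₚ.m^n>0 q j))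

odd-totient≡2⇒≡3 : ∀ q → 3 ≤ q → ∀ m → m ≥ 1 → q ^ m ∸ q ^ (m ∸ 1) ≡ 2 → q ^ m ≡ 3
odd-totient≡2⇒≡3 q@(suc (suc (suc r))) (s≤s (s≤s (s≤s _))) 1 _ φ≡2 =
  cong (λ r → (3 + r) * 1)
    (ℕₚ.+-cancelˡ-≡ 2 r 0 (trans (sym (ℕₚ.*-identityʳ (2 + r))) (trans (sym (totient-suc q 0)) φ≡2)))
odd-totient≡2⇒≡3 q@(suc (suc (suc r))) (s≤s (s≤s (s≤s _))) (suc (suc i)) _ φ≡2 =
  contradiction (subst (6 ≤_) (trans (sym (totient-suc q (suc i))) φ≡2) 6≤φ) λ { (s≤s (s≤s ())) }
  where
  6≤φ : 6 ≤ (q ∸ 1) * q ^ suc i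
  6≤φ = ℕₚ.*-mono-≤ {2} {q ∸ 1} {3} (ℕₚ.m≤m+n 2 r)
          (ℕₚ.≤-trans (ℕₚ.m≤m+n 3 r) (ℕₚ.m≤m*n q (q ^ i) {{ℕₚ.m^n≢0 q i}}))

2^[3+j]≡8+4g : ∀ j → ∃ λ g → 2 ^ (3 + j) ≡ 8 + 4 * g
2^[3+j]≡8+4g j = 2 * pred (2 ^ j) , lemma (2 ^ j) (ℕₚ.m^n>0 2 j)
  where
  8*suc : ∀ t → 2 * (2 * (2 * suc t)) ≡ 8 + 4 * (2 * t)
  8*suc = solve-∀
  lemma : ∀ x → 0 < x → 2 * (2 * (2 * x)) ≡ 8 + 4 * (2 * pred x)
  lemma (suc t) _ = 8*suc t

-- The ring ℤ_k

module ZModProperties (k : ℕ) .{{_ : NonZero k}} where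
  open ZMod k

  m*[n%k]%k≡m*n%k : ∀ m n → m * (n % k) % k ≡ m * n % k
  m*[n%k]%k≡m*n%k m n = begin
    m * (n % k) % k           ≡⟨ %-distribˡ-* m (n % k) k ⟩
    (m % k) * (n % k % k) % k ≡⟨ cong (λ r → (m % k) * r % k) (m%n%n≡m%n n k) ⟩
    (m % k) * (n % k) % k     ≡⟨ %-distribˡ-* m n k ⟨
    m * n % k                 ∎
    where open ≡-Reasoning

  toℕ-· : ∀ a b → toℕ (a · b) ≡ toℕ a * toℕ b % k
  toℕ-· a b = toℕ-fromℕ< _

  toℕ-0# : toℕ 0# ≡ 0
  toℕ-0# = trans (toℕ-fromℕ< _) (m<n⇒m%n≡m (>-nonZero⁻¹ k))

  toℕ-1# : 1 < k → toℕ 1# ≡ 1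
  toℕ-1# 1<k = trans (toℕ-fromℕ< _) (m<n⇒m%n≡m 1<k)

  1#≢0# : 1 < k → 1# ≢ 0#
  1#≢0# 1<k 1≡0 = ℕₚ.1+n≢0 (trans (sym (toℕ-1# 1<k)) (trans (cong toℕ 1≡0) toℕ-0#))

  ·-comm : ∀ a b → a · b ≡ b · a
  ·-comm a b = cong (_mod k) (ℕₚ.*-comm (toℕ a) (toℕ b))

  ·-assoc : ∀ a b c → (a · b) · c ≡ a · (b · c)
  ·-assoc a b c = toℕ-injective (begin
    toℕ ((a · b) · c)                ≡⟨ toℕ-· (a · b) c ⟩
    toℕ (a · b) * toℕ c % k          ≡⟨ cong (λ r → r * toℕ c % k) (toℕ-· a b) ⟩
    (toℕ a * toℕ b % k) * toℕ c % k  ≡⟨ cong (_% k) (ℕₚ.*-comm (toℕ a * toℕ b % k) (toℕ c)) ⟩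
    toℕ c * (toℕ a * toℕ b % k) % k  ≡⟨ m*[n%k]%k≡m*n%k (toℕ c) (toℕ a * toℕ b) ⟩
    toℕ c * (toℕ a * toℕ b) % k      ≡⟨ cong (_% k) (ℕₚ.*-comm (toℕ c) (toℕ a * toℕ b)) ⟩
    toℕ a * toℕ b * toℕ c % k        ≡⟨ cong (_% k) (ℕₚ.*-assoc (toℕ a) (toℕ b) (toℕ c)) ⟩
    toℕ a * (toℕ b * toℕ c) % k      ≡⟨ m*[n%k]%k≡m*n%k (toℕ a) (toℕ b * toℕ c) ⟨
    toℕ a * (toℕ b * toℕ c % k) % k  ≡⟨ cong (λ r → toℕ a * r % k) (toℕ-· b c) ⟨
    toℕ a * toℕ (b · c) % k          ≡⟨ toℕ-· a (b · c) ⟨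
    toℕ (a · (b · c))                ∎)
    where open ≡-Reasoning

  ·-identityʳ : ∀ a → a · 1# ≡ a
  ·-identityʳ a = toℕ-injective (begin
    toℕ (a · 1#)        ≡⟨ toℕ-· a 1# ⟩
    toℕ a * toℕ 1# % k  ≡⟨ cong (λ r → toℕ a * r % k) (toℕ-fromℕ< _) ⟩
    toℕ a * (1 % k) % k ≡⟨ m*[n%k]%k≡m*n%k (toℕ a) 1 ⟩
    toℕ a * 1 % k       ≡⟨ cong (_% k) (ℕₚ.*-identityʳ (toℕ a)) ⟩
    toℕ a % k           ≡⟨ m<n⇒m%n≡m (toℕ<n a) ⟩
    toℕ a               ∎)
    where open ≡-Reasoning

  inverse-unique : ∀ {u v w} → u · v ≡ 1# → u · w ≡ 1# → v ≡ w
  inverse-unique {u} {v} {w} uv≡1 uw≡1 = begin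
    v            ≡⟨ ·-identityʳ v ⟨
    v · 1#       ≡⟨ cong (v ·_) uw≡1 ⟨
    v · (u · w)  ≡⟨ ·-assoc v u w ⟨
    (v · u) · w  ≡⟨ cong (_· w) (trans (·-comm v u) uv≡1) ⟩
    1# · w       ≡⟨ ·-comm 1# w ⟩
    w · 1#       ≡⟨ ·-identityʳ w ⟩
    w            ∎
    where open ≡-Reasoning

  ·≡⇒multiple : ∀ a b {c} → a · b ≡ c → toℕ a * toℕ b ≡ toℕ c + (toℕ a * toℕ b / k) * k
  ·≡⇒multiple a b ab≡c = trans (m≡m%n+[m/n]*n (toℕ a * toℕ b) k)
    (cong (_+ _) (trans (sym (toℕ-· a b)) (cong toℕ ab≡c)))

  ·≡1#⇒multiple : 1 < k → ∀ a b → a · b ≡ 1# → toℕ a * toℕ b ≡ 1 + (toℕ a * toℕ b / k) * k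
  ·≡1#⇒multiple 1<k a b ab≡1 = trans (·≡⇒multiple a b ab≡1) (cong (_+ (toℕ a * toℕ b / k) * k) (toℕ-1# 1<k))

  multiple⇒inverse : ∀ u x m y → toℕ u * x + m * k ≡ 1 + y * k → u · (x mod k) ≡ 1#
  multiple⇒inverse u x m y eq = toℕ-injective (begin
    toℕ (u · (x mod k))        ≡⟨ toℕ-· u (x mod k) ⟩
    toℕ u * toℕ (x mod k) % k  ≡⟨ cong (λ r → toℕ u * r % k) (toℕ-fromℕ< _) ⟩
    toℕ u * (x % k) % k        ≡⟨ m*[n%k]%k≡m*n%k (toℕ u) x ⟩
    toℕ u * x % k              ≡⟨ [m+kn]%n≡m%n (toℕ u * x) m k ⟨
    (toℕ u * x + m * k) % k    ≡⟨ cong (_% k) eq ⟩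
    (1 + y * k) % k            ≡⟨ [m+kn]%n≡m%n 1 y k ⟩
    1 % k                      ≡⟨ toℕ-fromℕ< _ ⟨
    toℕ 1#                     ∎)
    where open ≡-Reasoning

  Unit : Set
  Unit = Σ Zk (T ∘ isUnit)

  isUnit⇒inverse : ∀ {u} → T (isUnit u) → ∃ λ v → u · v ≡ 1#
  isUnit⇒inverse {u} t = toWitness (proj₁ (Equivalence.to (T-∧ {⌊ any? (λ v → (u · v) Finₚ.≟ 1#) ⌋}) t))

  inverse⇒isUnit : ∀ {u} v → u · v ≡ 1# → T (isUnit u)
  inverse⇒isUnit {u} v uv≡1 = Equivalence.from (T-∧ {⌊ any? (λ w → (u · w) Finₚ.≟ 1#) ⌋})
    (fromWitness (v , uv≡1) , fromWitness (v , trans (·-comm v u) uv≡1))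

  isUnit⇒coprime : 1 < k → ∀ u → T (isUnit u) → Coprime (toℕ u) k
  isUnit⇒coprime 1<k u u-unit {d} (d∣u , d∣k) =
    ∣1⇒≡1 (∣m+n∣m⇒∣n (subst (d ∣_) (trans uv≡1+qk (ℕₚ.+-comm 1 _)) (∣m⇒∣m*n (toℕ v) d∣u))
                      (∣n⇒∣m*n (toℕ u * toℕ v / k) d∣k))
    where
    v = proj₁ (isUnit⇒inverse u-unit)
    uv≡1+qk = ·≡1#⇒multiple 1<k u v (proj₂ (isUnit⇒inverse u-unit))

  coprime⇒isUnit : ∀ u → Coprime (toℕ u) k → T (isUnit u)
  coprime⇒isUnit u u⊥k with coprime-Bézout u⊥k
  ... | Bézout.+- x y eq = inverse⇒isUnit (x mod k) (multiple⇒inverse u x 0 y (begin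
    toℕ u * x + 0  ≡⟨ ℕₚ.+-identityʳ _ ⟩
    toℕ u * x      ≡⟨ ℕₚ.*-comm (toℕ u) x ⟩
    x * toℕ u      ≡⟨ eq ⟨
    1 + y * k      ∎))
    where open ≡-Reasoning
  -- Here x·u ≡ −1 (mod k), so (x·u)² ≡ 1 and x·x·u is an inverse of u.
  ... | Bézout.-+ x y eq =
    inverse⇒isUnit (x * (x * û) mod k) (multiple⇒inverse u (x * (x * û)) (2 * y) (y * y * k) (begin
    û * (x * (x * û)) + 2 * y * k        ≡⟨ rearrange û x y k ⟩
    û * (x * (x * û)) + 2 * (y * k)      ≡⟨ cong (λ t → û * (x * (x * û)) + 2 * t) eq ⟨
    û * (x * (x * û)) + 2 * (1 + x * û)  ≡⟨ complete-square û x ⟩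
    1 + (1 + x * û) * (1 + x * û)        ≡⟨ cong (λ t → 1 + t * t) eq ⟩
    1 + (y * k) * (y * k)                ≡⟨ regroup y k ⟩
    1 + y * y * k * k                    ∎))
    where
    open ≡-Reasoning
    û = toℕ u
    rearrange : ∀ a x y k → a * (x * (x * a)) + 2 * y * k ≡ a * (x * (x * a)) + 2 * (y * k)
    rearrange = solve-∀
    complete-square : ∀ a x → a * (x * (x * a)) + 2 * (1 + x * a) ≡ 1 + (1 + x * a) * (1 + x * a)
    complete-square = solve-∀
    regroup : ∀ y k → 1 + (y * k) * (y * k) ≡ 1 + y * y * k * k
    regroup = solve-∀

  isUnit≡coprime? : 1 < k → ∀ u → isUnit u ≡ does (coprime? (toℕ u) k)
  isUnit≡coprime? 1<k u = T⇔⇒≡does (coprime? (toℕ u) k) (mk⇔ (isUnit⇒coprime 1<k u) (coprime⇒isUnit u))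

  _⁻¹ : Unit → Unit
  (u , u-unit) ⁻¹ = v , inverse⇒isUnit u (trans (·-comm v u) uv≡1)
    where v    = proj₁ (isUnit⇒inverse u-unit)
          uv≡1 = proj₂ (isUnit⇒inverse u-unit)

  ·-inverseʳ : ∀ x → proj₁ x · proj₁ (x ⁻¹) ≡ 1#
  ·-inverseʳ (_ , u-unit) = proj₂ (isUnit⇒inverse u-unit)

  ⁻¹-unique : ∀ x y → proj₁ x · proj₁ y ≡ 1# → y ≡ x ⁻¹
  ⁻¹-unique x y xy≡1 = proj₁-injective (inverse-unique {proj₁ x} xy≡1 (·-inverseʳ x))

  ⁻¹-involutive : ∀ x → x ⁻¹ ⁻¹ ≡ x
  ⁻¹-involutive x = sym (⁻¹-unique (x ⁻¹) x (trans (·-comm (proj₁ (x ⁻¹)) (proj₁ x)) (·-inverseʳ x)))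

  unitCount : ℕ
  unitCount = count isUnit

  unitInvolution : FiniteInvolution
  unitInvolution = record
    { Carrier      = Unit
    ; size         = unitCount
    ; enumeration  = subset↔Fin-count isUnit
    ; σ            = _⁻¹
    ; σ-involutive = ⁻¹-involutive
    }

  open FiniteInvolutionProperties unitInvolution public using (Fixed; fixedCount; Fixed↔Fin)

  isVertex₂⇔ : ∀ {e u} → T (isVertex₂ (e , u)) ⇔ (e · e ≡ e × e ≢ 0# × T (isUnit u))
  isVertex₂⇔ {e} {u} = mk⇔
    (λ t → let (e-idem , rest) = Equivalence.to (T-∧ {isIdem e}) t
               (e≢0 , u-unit)  = Equivalence.to (T-∧ {not ⌊ e Finₚ.≟ 0# ⌋}) rest
           in toWitness e-idem , toWitnessFalse e≢0 , u-unit)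
    (λ (ee≡e , e≢0 , u-unit) → Equivalence.from (T-∧ {isIdem e})
      (fromWitness ee≡e , Equivalence.from (T-∧ {not ⌊ e Finₚ.≟ 0# ⌋}) (fromWitnessFalse e≢0 , u-unit)))

  module _ (1<k : 1 < k) (idempotent≡1# : ∀ e → e · e ≡ e → e ≢ 0# → e ≡ 1#) where

    vertex≡1# : ∀ {e u} → T (isVertex₂ (e , u)) → e ≡ 1#
    vertex≡1# {e} t = let (ee≡e , e≢0 , _) = Equivalence.to isVertex₂⇔ t in idempotent≡1# e ee≡e e≢0

    vertex↔unit : Vertex₂ ↔ Unit
    vertex↔unit = mk↔ₛ′
      (λ ((_ , u) , t) → u , proj₂ (proj₂ (Equivalence.to isVertex₂⇔ t)))
      (λ (u , t) → (1# , u) , Equivalence.from isVertex₂⇔ (·-identityʳ 1# , 1#≢0# 1<k , t))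
      (λ _ → proj₁-injective refl)
      (λ ((_ , u) , t) → proj₁-injective (cong (_, u) (sym (vertex≡1# t))))

    trivialIdempotents⇒Cl₂≃pairingGraph : Cl₂ ≃ pairingGraph unitInvolution
    trivialIdempotents⇒Cl₂≃pairingGraph = isomorphism vertex↔unit λ x y → mk⇔ (to-adjacent x y) (from-adjacent x y)
      where
      open Inverse vertex↔unit
      to-adjacent : ∀ x y → Adj Cl₂ x y → Adj (pairingGraph unitInvolution) (to x) (to y)
      to-adjacent ((e , _) , s) ((f , _) , t) (_ , inj₁ (ef≡0 , _)) = contradiction (begin
        1#       ≡⟨ ·-identityʳ 1# ⟨
        1# · 1#  ≡⟨ cong₂ _·_ (vertex≡1# s) (vertex≡1# t) ⟨
        e · f    ≡⟨ ef≡0 ⟩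
        0#       ∎) (1#≢0# 1<k)
        where open ≡-Reasoning
      to-adjacent ((e , u) , s) ((f , v) , t) (eu≢fv , inj₂ (uv≡1 , _)) =
        (λ u≡v → eu≢fv (cong₂ _,_ (trans (vertex≡1# s) (sym (vertex≡1# t))) (cong proj₁ u≡v))) ,
        ⁻¹-unique _ _ uv≡1
      from-adjacent : ∀ x y → Adj (pairingGraph unitInvolution) (to x) (to y) → Adj Cl₂ x y
      from-adjacent ((e , u) , s) ((f , v) , t) (u≢v , v≡u⁻¹) =
        (λ eu≡fv → u≢v (proj₁-injective (cong proj₂ eu≡fv))) , inj₂ (uv≡1 , trans (·-comm v u) uv≡1)
        where uv≡1 = subst (λ w → u · proj₁ w ≡ 1#) (sym v≡u⁻¹) (·-inverseʳ (to ((e , u) , s)))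

  fixed⇒square≡1# : (x : Fixed) → proj₁ (proj₁ x) · proj₁ (proj₁ x) ≡ 1#
  fixed⇒square≡1# (x , x-fixed) = subst (λ y → proj₁ x · proj₁ y ≡ 1#) (toWitness x-fixed) (·-inverseʳ x)

  squareRoot : (u : Zk) → u · u ≡ 1# → Fixed
  squareRoot u uu≡1 = x , fromWitness (sym (⁻¹-unique x x uu≡1))
    where x = u , inverse⇒isUnit u uu≡1

  value : Fixed → ℕ
  value x = toℕ (proj₁ (proj₁ x))

  value-injective : ∀ {x y} → value x ≡ value y → x ≡ y
  value-injective eq = proj₁-injective (proj₁-injective (toℕ-injective eq))

  squareRootℕ : ∀ a c → a < k → a * a ≡ 1 + c * k → Fixed
  squareRootℕ a c a<k aa≡1+ck = squareRoot (a mod k) (multiple⇒inverse (a mod k) a 0 c (begin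
    toℕ (a mod k) * a + 0  ≡⟨ ℕₚ.+-identityʳ _ ⟩
    toℕ (a mod k) * a      ≡⟨ cong (_* a) (trans (toℕ-fromℕ< _) (m<n⇒m%n≡m a<k)) ⟩
    a * a                  ≡⟨ aa≡1+ck ⟩
    1 + c * k              ∎))
    where open ≡-Reasoning

  value-squareRootℕ : ∀ a c a<k aa≡1+ck → value (squareRootℕ a c a<k aa≡1+ck) ≡ a
  value-squareRootℕ a c a<k _ = trans (toℕ-fromℕ< _) (m<n⇒m%n≡m a<k)

  module _ (1<k : 1 < k) where

    private
      pred[k]<k : pred k < k
      pred[k]<k = ℕₚ.≤-reflexive (ℕₚ.suc-pred k)

      pred[k]² : pred k * pred k ≡ 1 + pred (pred k) * k
      pred[k]² = pred-square k 1<k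
        where
        pred-square : ∀ n → 1 < n → pred n * pred n ≡ 1 + pred (pred n) * n
        pred-square (suc (suc n)) _       = square-suc n
        pred-square (suc zero)    (s<s ())

    one minusOne : Fixed
    one      = squareRootℕ 1 0 1<k refl
    minusOne = squareRootℕ (pred k) (pred (pred k)) pred[k]<k pred[k]²

    value-one : value one ≡ 1
    value-one = value-squareRootℕ 1 0 1<k refl

    value-minusOne : value minusOne ≡ pred k
    value-minusOne = value-squareRootℕ (pred k) (pred (pred k)) pred[k]<k pred[k]²

  trivialSquareRoots⇒fixedCount≡2 : 2 < k → (∀ u → u · u ≡ 1# → toℕ u ≡ 1 ⊎ toℕ u ≡ pred k) → fixedCount ≡ 2
  trivialSquareRoots⇒fixedCount≡2 2<k trivial = ↔⇒≡ (two-element↔Fin2 one≢minusOne cover ↔-∘ ↔-sym Fixed↔Fin)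
    where
    1<k = ℕₚ.<-trans (s<s z<s) 2<k
    one≢minusOne : one 1<k ≢ minusOne 1<k
    one≢minusOne 1≡-1 = ℕₚ.<⇒≢ (ℕₚ.pred-mono-< 2<k)
      (trans (sym (value-one 1<k)) (trans (cong value 1≡-1) (value-minusOne 1<k)))
    cover : ∀ x → x ≡ one 1<k ⊎ x ≡ minusOne 1<k
    cover x = Sum.map (λ x≡1 → value-injective (trans x≡1 (sym (value-one 1<k))))
                      (λ x≡-1 → value-injective (trans x≡-1 (sym (value-minusOne 1<k))))
                      (trivial _ (fixed⇒square≡1# x))

  3≤fixedCount : ∀ g → k ≡ 8 + 4 * g → 3 ≤ fixedCount
  3≤fixedCount g k≡8+4g = three-distinct⇒3≤ Fixed↔Fin {one 1<k} {middle} {minusOne 1<k}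
    (values-differ (value-one 1<k) value-middle λ ())
    (values-differ (value-one 1<k) (value-minusOne 1<k) λ 1≡pred[k] →
      contradiction (trans 1≡pred[k] pred[k]≡7+4g) λ ())
    (values-differ value-middle (value-minusOne 1<k) λ eq → ℕₚ.<⇒≢ 3+2g<7+4g (trans eq pred[k]≡7+4g))
    where
    1<k : 1 < k
    1<k = subst (1 <_) (sym k≡8+4g) (s<s z<s)
    pred[k]≡7+4g : pred k ≡ 7 + 4 * g
    pred[k]≡7+4g = cong pred k≡8+4g
    3+2g<7+4g : 3 + 2 * g < 7 + 4 * g
    3+2g<7+4g = ℕₚ.+-mono-<-≤ (ℕₚ.m<m+n 3 {4} z<s) (ℕₚ.*-monoˡ-≤ g (ℕₚ.m≤m+n 2 2))
    -- Besides ±1, also k/2 − 1 = 3 + 2g squares to 1.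
    square-middle : ∀ g → (3 + 2 * g) * (3 + 2 * g) ≡ 1 + (1 + g) * (8 + 4 * g)
    square-middle = solve-∀
    3+2g<k : 3 + 2 * g < k
    3+2g<k = subst (3 + 2 * g <_) (sym k≡8+4g) (ℕₚ.<-trans 3+2g<7+4g (ℕₚ.n<1+n _))
    [3+2g]² : (3 + 2 * g) * (3 + 2 * g) ≡ 1 + (1 + g) * k
    [3+2g]² = trans (square-middle g) (cong (λ m → 1 + (1 + g) * m) (sym k≡8+4g))
    middle : Fixed
    middle = squareRootℕ (3 + 2 * g) (1 + g) 3+2g<k [3+2g]²
    value-middle : value middle ≡ 3 + 2 * g
    value-middle = value-squareRootℕ (3 + 2 * g) (1 + g) 3+2g<k [3+2g]²
    values-differ : ∀ {x y m n} → value x ≡ m → value y ≡ n → m ≢ n → x ≢ y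
    values-differ x≡m y≡n m≢n x≡y = m≢n (trans (sym x≡m) (trans (cong value x≡y) y≡n))

-- The ring ℤ_{p^n}

module PrimePower (p : ℕ) (p-prime : Prime p) (n : ℕ) where

  private instance
    p≢0 : NonZero p
    p≢0 = prime⇒nonZero p-prime
    pⁿ≢0 : NonZero (p ^ n)
    pⁿ≢0 = ℕₚ.m^n≢0 p n

  open ZMod (p ^ n) {{pⁿ≢0}}
  open ZModProperties (p ^ n) {{pⁿ≢0}} public

  module _ (n≥1 : n ≥ 1) where

    1<pⁿ : 1 < p ^ n
    1<pⁿ = prime-power>1 p-prime n n≥1

    idempotent≡1# : ∀ e → e · e ≡ e → e ≢ 0# → e ≡ 1#
    idempotent≡1# e ee≡e e≢0
      with idempotent-mod-prime-power p-prime n (toℕ e) (toℕ e * toℕ e / p ^ n) (toℕ<n e) (·≡⇒multiple e e ee≡e)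
    ... | inj₁ e≡0 = contradiction (toℕ-injective (trans e≡0 (sym toℕ-0#))) e≢0
    ... | inj₂ e≡1 = toℕ-injective (trans e≡1 (sym (toℕ-1# 1<pⁿ)))

    Cl₂≃pairingGraph : Cl₂ ≃ pairingGraph unitInvolution
    Cl₂≃pairingGraph = trivialIdempotents⇒Cl₂≃pairingGraph 1<pⁿ idempotent≡1#

    unitCount≡totient : unitCount ≡ p ^ n ∸ p ^ (n ∸ 1)
    unitCount≡totient = begin
      count isUnit                                          ≡⟨ count-cong (isUnit≡coprime? 1<pⁿ) ⟩
      count {p ^ n} (λ u → does (coprime? (toℕ u) (p ^ n))) ≡⟨ count-toℕ (p ^ n) _ ⟩
      countBelow (p ^ n) (λ a → does (coprime? a (p ^ n)))  ≡⟨ countBelow-cong (p ^ n) coprime≡notDivisible ⟩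
      countBelow (p ^ n) (notDivisibleBy p)                 ≡⟨ countBelow-notDivisibleBy-^ p n n≥1 ⟩
      p ^ n ∸ p ^ (n ∸ 1)                                   ∎
      where
      open ≡-Reasoning
      coprime≡notDivisible : ∀ a → a < p ^ n → does (coprime? a (p ^ n)) ≡ notDivisibleBy p a
      coprime≡notDivisible a _ = does-⇔ (coprime-prime-power⇔∤ p-prime n n≥1) (coprime? a (p ^ n)) (¬? (p ∣? a))

    odd⇒fixedCount≡2 : p ≢ 2 → fixedCount ≡ 2
    odd⇒fixedCount≡2 p≢2 = trivialSquareRoots⇒fixedCount≡2 2<pⁿ λ u uu≡1 →
      square-root-of-one-mod-odd-prime-power p-prime p≢2 n (toℕ u) (toℕ u * toℕ u / p ^ n) (toℕ<n u)
        (·≡1#⇒multiple 1<pⁿ u u uu≡1)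
      where
      2<pⁿ : 2 < p ^ n
      2<pⁿ = ℕₚ.<-≤-trans (odd-prime≥3 p-prime p≢2) (subst (_≤ p ^ n) (ℕₚ.*-identityʳ p) (ℕₚ.^-monoʳ-≤ p n≥1))

-- The classification

modulus-cong : (f : (k : ℕ) → .{{NonZero k}} → A) {k l : ℕ} .{{_ : NonZero k}} .{{_ : NonZero l}} →
  k ≡ l → f k ≡ f l
modulus-cong f refl = refl

IsomorphismCondition : (p q n m : ℕ) → Set
IsomorphismCondition p q n m =
  ((p ^ n ≡ 4) × (q ^ m ≡ 3)) ⊎ ((p ^ n ≡ 3) × (q ^ m ≡ 4))
  ⊎ ((¬ (p ≡ 2)) × (¬ (q ≡ 2)) × (p ^ n ∸ p ^ (n ∸ 1) ≡ q ^ m ∸ q ^ (m ∸ 1)))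

SameCounts : ∀ {p q} → Prime p → Prime q → ℕ → ℕ → Set
SameCounts {p} {q} p-prime q-prime n m =
  PrimePower.unitCount p p-prime n ≡ PrimePower.unitCount q q-prime m ×
  PrimePower.fixedCount p p-prime n ≡ PrimePower.fixedCount q q-prime m

sameCounts-2-odd⇒4-3 : ∀ {q n m} (two-prime : Prime 2) (q-prime : Prime q) → q ≢ 2 → n ≥ 1 → m ≥ 1 →
  SameCounts two-prime q-prime n m → (2 ^ n ≡ 4) × (q ^ m ≡ 3)
sameCounts-2-odd⇒4-3 {q} {n} {m} two-prime q-prime q≢2 n≥1 m≥1 (units≡ , fixed≡) =
  classify n n≥1 (trans units≡ (Q.unitCount≡totient m≥1)) (trans fixed≡ (Q.odd⇒fixedCount≡2 m≥1 q≢2))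
  where
  module Q = PrimePower q q-prime m
  3≤q = odd-prime≥3 q-prime q≢2
  classify : ∀ n → n ≥ 1 → PrimePower.unitCount 2 two-prime n ≡ q ^ m ∸ q ^ (m ∸ 1) →
    PrimePower.fixedCount 2 two-prime n ≡ 2 → (2 ^ n ≡ 4) × (q ^ m ≡ 3)
  classify 1 _ φ≡ _ = contradiction (subst (2 ≤_) (sym φ≡) (odd-totient≥2 q 3≤q m m≥1)) λ { (s≤s ()) }
  classify 2 _ φ≡ _ = refl , odd-totient≡2⇒≡3 q 3≤q m m≥1 (sym φ≡)
  classify (suc (suc (suc j))) _ _ fixed≡2 = contradiction
    (subst (3 ≤_) fixed≡2 (PrimePower.3≤fixedCount 2 two-prime (suc (suc (suc j))) (proj₁ g,eq) (proj₂ g,eq)))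
    λ { (s≤s (s≤s ())) }
    where g,eq = 2^[3+j]≡8+4g j

-- Both counts of ℤ₄ and of ℤ₃ evaluate to 2, which closes the middle step of each trans.
sameCounts-4-3 : ∀ {p q n m} (p-prime : Prime p) (q-prime : Prime q) → p ^ n ≡ 4 → q ^ m ≡ 3 →
  SameCounts p-prime q-prime n m
sameCounts-4-3 {p} {q} {n} {m} p-prime q-prime pⁿ≡4 qᵐ≡3 =
  trans (modulus-cong ZModProperties.unitCount pⁿ≡4) (modulus-cong ZModProperties.unitCount (sym qᵐ≡3)) ,
  trans (modulus-cong ZModProperties.fixedCount pⁿ≡4) (modulus-cong ZModProperties.fixedCount (sym qᵐ≡3))
  where instance
    pⁿ≢0 = ℕₚ.m^n≢0 p n {{prime⇒nonZero p-prime}}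
    qᵐ≢0 = ℕₚ.m^n≢0 q m {{prime⇒nonZero q-prime}}

sameCounts⇒condition : ∀ p q (p-prime : Prime p) (q-prime : Prime q) → p ≢ q → ∀ n m → n ≥ 1 → m ≥ 1 →
  Dec (p ≡ 2) → Dec (q ≡ 2) → SameCounts p-prime q-prime n m → IsomorphismCondition p q n m
sameCounts⇒condition p q p-prime q-prime p≢q n m n≥1 m≥1 (yes refl) (yes refl) _ = contradiction refl p≢q
sameCounts⇒condition p q p-prime q-prime p≢q n m n≥1 m≥1 (yes refl) (no q≢2) counts =
  inj₁ (sameCounts-2-odd⇒4-3 p-prime q-prime q≢2 n≥1 m≥1 counts)
sameCounts⇒condition p q p-prime q-prime p≢q n m n≥1 m≥1 (no p≢2) (yes refl) counts =
  inj₂ (inj₁ (swap (sameCounts-2-odd⇒4-3 q-prime p-prime p≢2 m≥1 n≥1 (Product.map sym sym counts))))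
sameCounts⇒condition p q p-prime q-prime p≢q n m n≥1 m≥1 (no p≢2) (no q≢2) (units≡ , _) =
  inj₂ (inj₂ (p≢2 , q≢2 , trans (sym (PrimePower.unitCount≡totient p p-prime n n≥1))
                                (trans units≡ (PrimePower.unitCount≡totient q q-prime m m≥1))))

condition⇒sameCounts : ∀ p q (p-prime : Prime p) (q-prime : Prime q) → ∀ n m → n ≥ 1 → m ≥ 1 →
  IsomorphismCondition p q n m → SameCounts p-prime q-prime n m
condition⇒sameCounts p q p-prime q-prime n m n≥1 m≥1 (inj₁ (pⁿ≡4 , qᵐ≡3)) =
  sameCounts-4-3 {n = n} {m} p-prime q-prime pⁿ≡4 qᵐ≡3
condition⇒sameCounts p q p-prime q-prime n m n≥1 m≥1 (inj₂ (inj₁ (pⁿ≡3 , qᵐ≡4))) =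
  Product.map sym sym (sameCounts-4-3 {n = m} {n} q-prime p-prime qᵐ≡4 pⁿ≡3)
condition⇒sameCounts p q p-prime q-prime n m n≥1 m≥1 (inj₂ (inj₂ (p≢2 , q≢2 , φ≡))) =
  trans (P.unitCount≡totient n≥1) (trans φ≡ (sym (Q.unitCount≡totient m≥1))) ,
  trans (P.odd⇒fixedCount≡2 n≥1 p≢2) (sym (Q.odd⇒fixedCount≡2 m≥1 q≢2))
  where
  module P = PrimePower p p-prime n
  module Q = PrimePower q q-prime m

mainTheorem5 : (p q : ℕ) (pp : Prime p) (qp : Prime q) → ¬ (p ≡ q) →
    (n m : ℕ) → n ≥ 1 → m ≥ 1 →
    (Cl₂-pow p pp n ≅ Cl₂-pow q qp m) ⇔
      (((p ^ n ≡ 4) × (q ^ m ≡ 3)) ⊎ ((p ^ n ≡ 3) × (q ^ m ≡ 4))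
       ⊎ ((¬ (p ≡ 2)) × (¬ (q ≡ 2)) × (p ^ n ∸ p ^ (n ∸ 1) ≡ q ^ m ∸ q ^ (m ∸ 1))))
mainTheorem5 p q pp qp p≢q n m n≥1 m≥1 = begin
  Cl₂-pow p pp n ≅ Cl₂-pow q qp m
    ∼⟨ ≅⇔≃-cong (P.Cl₂≃pairingGraph n≥1) (Q.Cl₂≃pairingGraph m≥1) ⟩
  pairingGraph P.unitInvolution ≃ pairingGraph Q.unitInvolution
    ∼⟨ pairingGraph-≃⇔counts {P.unitInvolution} {Q.unitInvolution} ⟩
  SameCounts pp qp n m
    ∼⟨ mk⇔ (sameCounts⇒condition p q pp qp p≢q n m n≥1 m≥1 (p ℕ.≟ 2) (q ℕ.≟ 2))
           (condition⇒sameCounts p q pp qp n m n≥1 m≥1) ⟩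
  IsomorphismCondition p q n m
    ∎
  where
  module P = PrimePower p pp n
  module Q = PrimePower q qp m
  open Related.EquationalReasoning {k = Related.equivalence}
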